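{- Let $H$ be a fixed graph, not necessarily complete or connected. If $G'$ is an induced subgraph of $G$, then $\mathsf{bed}^+_{\mathcal{F}_{\bar H}}(G') \leq \mathsf{bed}^+_{\mathcal{F}_{\bar H}}(G)$.
   Context: For a connected graph $G$, a root of $G$ (w.r.t. $H$) is a nonempty $T\subseteq V(G)$ such that $G[T]$ is connected and contains no subgraph isomorphic to $H$, and every connected component $C$ of $G-T$ satisfies $|N(C)\cap T|=1$. $\mathsf{bed}^+_{\mathcal{F}_{\bar H}}(G)$ is defined recursively: $0$ if $V(G)=\emptyset$; $\mathsf{bed}^+_{\mathcal{F}_{\bar H}}(G-v)$ if $v$ is a vertex in no subgraph of $G$ isomorphic to $H$; $\max_i\mathsf{bed}^+_{\mathcal{F}_{\bar H}}(C_i)$ if $G$ has connected components $C_1,\dots,C_c$ with $c\ge2$; otherwise $1+\min_T\mathsf{bed}^+_{\mathcal{F}_{\bar H}}(G-T)$ over all roots $T$ of $G$. -}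

module Defs where

open import Data.Nat using (ℕ; zero; suc; _≤_)
open import Data.Fin using (Fin)
open import Data.Fin.Subset using (Subset; _∈_; _∉_; _⊆_; _─_; _-_; Nonempty; Empty; ⊤)
open import Data.Product using (Σ; ∃; ∃-syntax; _×_; _,_; proj₁)
open import Data.Empty using (⊥)
open import Relation.Nullary using (¬_)
open import Relation.Binary.PropositionalEquality using (_≡_; _≢_)
open import Function.Definitions using (Injective)

record Graph : Set₁ where
  field
    size   : ℕ
    Adj    : Fin size → Fin size → Set
    sym    : ∀ {u v} → Adj u v → Adj v u
    irrefl : ∀ {u} → ¬ Adj u u
open Graph public

-- Throughout, G is an ambient graph and a vertex set S : Subset (size G)
-- stands for the induced subgraph G[S].
module _ (G : Graph) where
  private
    n = size G
    V = Fin n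

  -- A subgraph of G[S] isomorphic to H (not necessarily induced):
  -- an injective, edge-preserving map V(H) → S.
  record Copy (H : Graph) (S : Subset n) : Set where
    field
      φ        : Fin (size H) → V
      injective : Injective _≡_ _≡_ φ
      inside   : ∀ i → φ i ∈ S
      edges    : ∀ {i j} → Adj H i j → Adj G (φ i) (φ j)

  InCopy : (H : Graph) → Subset n → V → Set
  InCopy H S v = Σ (Copy H S) λ c → ∃[ i ] Copy.φ c i ≡ v

  HFree : Graph → Subset n → Set
  HFree H S = ¬ Copy H S

  data Reach (S : Subset n) : V → V → Set where
    here : ∀ {u} → u ∈ S → Reach S u u
    step : ∀ {u w v} → u ∈ S → Adj G u w → Reach S w v → Reach S u v

  Connected : Subset n → Set
  Connected S = ∀ {u v} → u ∈ S → v ∈ S → Reach S u v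

  record IsComponent (S C : Subset n) : Set where
    field
      sub      : C ⊆ S
      nonempty : Nonempty C
      conn     : Connected C
      closed   : ∀ {u v} → u ∈ C → v ∈ S → Adj G u v → v ∈ C

  Component : Subset n → Set
  Component S = Σ (Subset n) (IsComponent S)

  ManyComponents : Subset n → Set
  ManyComponents S = Σ (Component S) λ C₁ → Σ (Component S) λ C₂ → proj₁ C₁ ≢ proj₁ C₂

  NbrOf : Subset n → V → Set
  NbrOf C t = t ∉ C × ∃[ c ] (c ∈ C × Adj G c t)

  record IsRoot (H : Graph) (S T : Subset n) : Set where
    field
      sub      : T ⊆ S
      nonempty : Nonempty T
      conn     : Connected T
      hfree    : HFree H T
      oneNbr   : ∀ (C : Component (S ─ T)) →
                 ∃[ t ] ((t ∈ T × NbrOf (proj₁ C) t) ×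
                         (∀ {t'} → t' ∈ T → NbrOf (proj₁ C) t' → t' ≡ t))

  Root : Graph → Subset n → Set
  Root H S = Σ (Subset n) (IsRoot H S)

  -- IsBed H S k : bed⁺_{F_H̄}(G[S]) = k, following the recursive definition
  -- clause by clause (clauses are tried in the stated order).
  data IsBed (H : Graph) : Subset n → ℕ → Set where
    empty : ∀ {S} → Empty S → IsBed H S 0
    free  : ∀ {S v k} → v ∈ S → ¬ InCopy H S v →
            IsBed H (S - v) k → IsBed H S k
    comps : ∀ {S} (k : ℕ) →
            (∀ {v} → v ∈ S → InCopy H S v) →
            ManyComponents S →
            (f : (C : Component S) → Σ ℕ (IsBed H (proj₁ C))) →
            (∀ C → proj₁ (f C) ≤ k) →
            (∃[ C ] proj₁ (f C) ≡ k) →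
            IsBed H S k
    root  : ∀ {S} →
            Nonempty S →
            (∀ {v} → v ∈ S → InCopy H S v) →
            ¬ ManyComponents S →
            (f : (T : Root H S) → Σ ℕ (IsBed H (S ─ proj₁ T))) →
            (T₀ : Root H S) →
            (∀ T → proj₁ (f T₀) ≤ proj₁ (f T)) →
            IsBed H S (suc (proj₁ (f T₀)))

{-# OPTIONS --safe #-}
module Submission where

-- Induct on the two bed⁺ derivations, for G[S] inside G[S'] (S ⊆ S'). If G[S] is split by
-- a root while G[S'] deletes a vertex or splits into components, then G[S] avoids that
-- vertex or lies inside one component. The substantial case is when both are split by roots
-- and S meets the optimal root T₀ of G[S']: then T = S ∩ T₀ is a root of G[S] with
-- S − T ⊆ S' − T₀. T is connected since every component of G[S'] − T₀ has a single
-- neighbour in T₀, so an excursion of a path of G[S] outside T₀ returns to the vertex where it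
-- left T₀; for the same reason each component of G[S] − T has a single neighbour in T.

open import Defs
open import Data.Nat using (ℕ; _≤_; z≤n; s≤s; _≤?_)
open import Data.Nat.Properties using (≤-trans; n≤1+n)
open import Data.Fin using (Fin)
open import Data.Fin.Properties using (sequence)
open import Data.Fin.Subset using (Subset; ⊤; _∈_; _∉_; _⊆_; _─_; _-_; _∩_; inside; outside)
open import Data.Fin.Subset.Properties using (_∈?_; nonempty?; ⊆⊤; p∩q⊆p; p∩q⊆q; x∈p∩q⁺; x∈⁅y⁆⇒x≡y)
open import Data.Vec using ([]; _∷_; here; there; tabulate)
open import Data.Vec.Properties using (lookup∘tabulate; lookup⇒[]=; []=⇒lookup)
open import Data.Product using (∃-syntax; _×_; _,_; proj₁; proj₂)
open import Data.Sum using (_⊎_; inj₁; inj₂)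
open import Data.Empty using (⊥-elim)
open import Level using (0ℓ)
open import Effect.Monad using (RawMonad)
open import Function using (_∘_)
open import Relation.Nullary using (¬_; Dec; yes; no; does)
open import Relation.Nullary.Decidable using (decidable-stable; dec-true; ¬¬-excluded-middle)
open import Relation.Nullary.Negation using (¬¬-Monad; ¬¬-map)
import Relation.Binary.PropositionalEquality as ≡
open ≡ using (_≡_; refl)

x∈p─q⁺ : ∀ {n} {x : Fin n} {p q : Subset n} → x ∈ p × x ∉ q → x ∈ p ─ q
x∈p─q⁺ {q = outside ∷ _} (here , _)        = here
x∈p─q⁺ {q = inside  ∷ _} (here , x∉q)      = ⊥-elim (x∉q here)
x∈p─q⁺ {q = _       ∷ _} (there x∈p , x∉q) = there (x∈p─q⁺ (x∈p , x∉q ∘ there))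

x∈p─q⁻ : ∀ {n} {x : Fin n} (p q : Subset n) → x ∈ p ─ q → x ∈ p × x ∉ q
x∈p─q⁻ {x = Fin.zero} (inside ∷ _) (outside ∷ _) here = here , λ ()
x∈p─q⁻ {x = Fin.suc _} (_ ∷ p) (_ ∷ q) (there x∈p─q) =
  let x∈p , x∉q = x∈p─q⁻ p q x∈p─q in there x∈p , λ { (there x∈q) → x∉q x∈q }

⊆-─ : ∀ {n} {p q r : Subset n} → p ⊆ q → (∀ {x} → x ∈ p → x ∉ r) → p ⊆ q ─ r
⊆-─ p⊆q p∉r x∈p = x∈p─q⁺ (p⊆q x∈p , p∉r x∈p)

module _ {n} {P : Fin n → Set} (P? : ∀ x → Dec (P x)) where

  subsetOf : Subset n
  subsetOf = tabulate (does ∘ P?)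

  ∈-subsetOf⁺ : ∀ {x} → P x → x ∈ subsetOf
  ∈-subsetOf⁺ {x} Px = lookup⇒[]= x subsetOf (≡.trans (lookup∘tabulate _ x) (dec-true (P? x) Px))

  ∈-subsetOf⁻ : ∀ {x} → x ∈ subsetOf → P x
  ∈-subsetOf⁻ {x} x∈P with P? x | ≡.trans (≡.sym (lookup∘tabulate (does ∘ P?) x)) ([]=⇒lookup x∈P)
  ... | yes Px | _ = Px
  ... | no _   | ()

module _ where
  open RawMonad (¬¬-Monad {a = 0ℓ})

  ¬¬-∀-Subset : ∀ n {P : Subset n → Set} → (∀ p → ¬ ¬ P p) → ¬ ¬ (∀ p → P p)
  ¬¬-∀-Subset ℕ.zero    ¬¬P = ¬¬-map (λ { P[] [] → P[] }) (¬¬P [])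
  ¬¬-∀-Subset (ℕ.suc n) ¬¬P = do
    P-in  ← ¬¬-∀-Subset n (¬¬P ∘ (inside ∷_))
    P-out ← ¬¬-∀-Subset n (¬¬P ∘ (outside ∷_))
    pure λ { (inside ∷ p) → P-in p ; (outside ∷ p) → P-out p }

  -- Adj is an arbitrary relation, so reachability is decidable only up to double negation;
  -- that suffices because the conclusion k' ≤ k is decidable.
  ¬¬-reach? : (G : Graph) → ¬ ¬ (∀ S u v → Dec (Reach G S u v))
  ¬¬-reach? G = ¬¬-∀-Subset (size G) λ S →
    sequence rawApplicative λ u → sequence rawApplicative λ v → ¬¬-excluded-middle

module _ {G : Graph} where

  reach-start : ∀ {S u v} → Reach G S u v → u ∈ S
  reach-start (here u∈S)     = u∈S
  reach-start (step u∈S _ _) = u∈S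

  reach-end : ∀ {S u v} → Reach G S u v → v ∈ S
  reach-end (here v∈S)     = v∈S
  reach-end (step _ _ w⇝v) = reach-end w⇝v

  reach-mono : ∀ {S S' u v} → S ⊆ S' → Reach G S u v → Reach G S' u v
  reach-mono S⊆S' (here u∈S)         = here (S⊆S' u∈S)
  reach-mono S⊆S' (step u∈S u~w w⇝v) = step (S⊆S' u∈S) u~w (reach-mono S⊆S' w⇝v)

  reach-++ : ∀ {S u v w} → Reach G S u v → Reach G S v w → Reach G S u w
  reach-++ (here _)           v⇝w = v⇝w
  reach-++ (step u∈S u~x x⇝v) v⇝w = step u∈S u~x (reach-++ x⇝v v⇝w)

  reach-snoc : ∀ {S u v w} → Reach G S u v → Adj G v w → w ∈ S → Reach G S u w
  reach-snoc u⇝v v~w w∈S = reach-++ u⇝v (step (reach-end u⇝v) v~w (here w∈S))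

  reach-reverse : ∀ {S u v} → Reach G S u v → Reach G S v u
  reach-reverse (here u∈S)         = here u∈S
  reach-reverse (step u∈S u~w w⇝v) = reach-snoc (reach-reverse w⇝v) (sym G u~w) u∈S

  reach-exit : ∀ {S u v} (D : Subset (size G)) → Reach G S u v → u ∈ D → v ∉ D →
               ∃[ c ] ∃[ y ] (c ∈ D × y ∉ D × y ∈ S × Adj G c y)
  reach-exit D (here _) u∈D v∉D = ⊥-elim (v∉D u∈D)
  reach-exit {u = u} D (step _ u~w w⇝v) u∈D v∉D with _ ∈? D
  ... | yes w∈D = reach-exit D w⇝v w∈D v∉D
  ... | no  w∉D = u , _ , u∈D , w∉D , reach-start w⇝v , u~w

  copy-mono : ∀ {H S S'} → S ⊆ S' → Copy G H S → Copy G H S'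
  copy-mono S⊆S' c = record
    { φ = Copy.φ c ; injective = Copy.injective c
    ; inside = S⊆S' ∘ Copy.inside c ; edges = Copy.edges c }

  inCopy-mono : ∀ {H S S' v} → S ⊆ S' → InCopy G H S v → InCopy G H S' v
  inCopy-mono S⊆S' (c , i) = copy-mono S⊆S' c , i

module _ {G : Graph} (reach? : ∀ S u v → Dec (Reach G S u v)) where

  componentOf : Subset (size G) → Fin (size G) → Subset (size G)
  componentOf S u = subsetOf (reach? S u)

  ∈-componentOf⁺ : ∀ {S u x} → Reach G S u x → x ∈ componentOf S u
  ∈-componentOf⁺ {S} {u} = ∈-subsetOf⁺ (reach? S u)

  ∈-componentOf⁻ : ∀ {S u x} → x ∈ componentOf S u → Reach G S u x
  ∈-componentOf⁻ {S} {u} = ∈-subsetOf⁻ (reach? S u)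

  componentOf-isComponent : ∀ {S u} → u ∈ S → IsComponent G S (componentOf S u)
  componentOf-isComponent {S} {u} u∈S = record
    { sub      = reach-end ∘ ∈-componentOf⁻
    ; nonempty = u , ∈-componentOf⁺ (here u∈S)
    ; conn     = λ v∈C w∈C → let u⇝v = ∈-componentOf⁻ v∈C in
                   within u⇝v (reach-++ (reach-reverse u⇝v) (∈-componentOf⁻ w∈C))
    ; closed   = λ v∈C w∈S v~w → ∈-componentOf⁺ (reach-snoc (∈-componentOf⁻ v∈C) v~w w∈S)
    }
    where
      within : ∀ {v w} → Reach G S u v → Reach G S v w → Reach G (componentOf S u) v w
      within u⇝v (here _)         = here (∈-componentOf⁺ u⇝v)
      within u⇝v (step _ v~x x⇝w) =
        step (∈-componentOf⁺ u⇝v) v~x (within (reach-snoc u⇝v v~x (reach-start x⇝w)) x⇝w)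

  component : ∀ {S u} → u ∈ S → Component G S
  component u∈S = componentOf _ _ , componentOf-isComponent u∈S

  ¬many⇒connected : ∀ {S} → ¬ ManyComponents G S → Connected G S
  ¬many⇒connected {S} one {u} {v} u∈S v∈S = decidable-stable (reach? S u v) λ u⇝̸v →
    one (component u∈S , component v∈S , λ Cu≡Cv →
      u⇝̸v (∈-componentOf⁻ (≡.subst (v ∈_) (≡.sym Cu≡Cv) (∈-componentOf⁺ (here v∈S)))))

  ⊆-componentOf : ∀ {S S' u} → Connected G S → S ⊆ S' → u ∈ S → S ⊆ componentOf S' u
  ⊆-componentOf S-conn S⊆S' u∈S x∈S = ∈-componentOf⁺ (reach-mono S⊆S' (S-conn u∈S x∈S))

  module RootRestriction {H S S' T₀} (S⊆S' : S ⊆ S') (T₀-root : IsRoot G H S' T₀)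
                         (S-conn : Connected G S) where

    T R : Subset (size G)
    T = S ∩ T₀
    R = S' ─ T₀

    T⊆S : T ⊆ S
    T⊆S = p∩q⊆p S T₀

    T⊆T₀ : T ⊆ T₀
    T⊆T₀ = p∩q⊆q S T₀

    ∈R : ∀ {x} → x ∈ S → x ∉ T₀ → x ∈ R
    ∈R x∈S x∉T₀ = x∈p─q⁺ (S⊆S' x∈S , x∉T₀)

    ∉T₀ : ∀ {x} → x ∈ R → x ∉ T₀
    ∉T₀ = proj₂ ∘ x∈p─q⁻ S' T₀

    S─T⊆R : S ─ T ⊆ R
    S─T⊆R x∈S─T = let x∈S , x∉T = x∈p─q⁻ S T x∈S─T in
      ∈R x∈S λ x∈T₀ → x∉T (x∈p∩q⁺ (x∈S , x∈T₀))

    Attached : Fin (size G) → Fin (size G) → Set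
    Attached t x = ∃[ c ] (Adj G t c × Reach G R c x)

    attached-unique : ∀ {t t' x} → t ∈ T₀ → t' ∈ T₀ → Attached t x → Attached t' x → t ≡ t'
    attached-unique {x = x} t∈T₀ t'∈T₀ t-x@(_ , _ , c⇝x) t'-x =
      let _ , _ , unique = IsRoot.oneNbr T₀-root (component (reach-end c⇝x)) in
      ≡.trans (unique t∈T₀ (neighbour t∈T₀ t-x)) (≡.sym (unique t'∈T₀ (neighbour t'∈T₀ t'-x)))
      where
        neighbour : ∀ {t} → t ∈ T₀ → Attached t x → NbrOf G (componentOf R x) t
        neighbour t∈T₀ (c , t~c , c⇝x) =
          (λ t∈E → ∉T₀ (reach-end (∈-componentOf⁻ t∈E)) t∈T₀) ,
          c , ∈-componentOf⁺ (reach-reverse c⇝x) , sym G t~c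

    path-in-T : ∀ {t x b} → t ∈ T → b ∈ T₀ → x ≡ t ⊎ Attached t x → Reach G S x b → Reach G T t b
    path-in-T t∈T _ (inj₁ refl) (here _) = here t∈T
    path-in-T _ b∈T₀ (inj₂ (_ , _ , c⇝b)) (here _) = ⊥-elim (∉T₀ (reach-end c⇝b) b∈T₀)
    path-in-T t∈T b∈T₀ x-at-t (step {u = x} {w = y} _ x~y y⇝b) with y ∈? T₀ | x-at-t
    ... | yes y∈T₀ | inj₁ refl =
      step t∈T x~y (path-in-T (x∈p∩q⁺ (reach-start y⇝b , y∈T₀)) b∈T₀ (inj₁ refl) y⇝b)
    ... | yes y∈T₀ | inj₂ t-x@(_ , _ , c⇝x) =
      let y≡t = attached-unique y∈T₀ (T⊆T₀ t∈T) (x , sym G x~y , here (reach-end c⇝x)) t-x in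
      path-in-T t∈T b∈T₀ (inj₁ y≡t) y⇝b
    ... | no  y∉T₀ | inj₁ refl =
      path-in-T t∈T b∈T₀ (inj₂ (y , x~y , here (∈R (reach-start y⇝b) y∉T₀))) y⇝b
    ... | no  y∉T₀ | inj₂ (c , t~c , c⇝x) =
      path-in-T t∈T b∈T₀ (inj₂ (c , t~c , reach-snoc c⇝x x~y (∈R (reach-start y⇝b) y∉T₀))) y⇝b

    T-connected : Connected G T
    T-connected t∈T b∈T = path-in-T t∈T (T⊆T₀ b∈T) (inj₁ refl) (S-conn (T⊆S t∈T) (T⊆S b∈T))

    module _ {D} (D-comp : IsComponent G (S ─ T) D) where
      open IsComponent D-comp

      attachment-exists : ∀ {a} → a ∈ T → ∃[ t ] (t ∈ T × NbrOf G D t)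
      attachment-exists a∈T =
        let d , d∈D = nonempty
            d∈S = proj₁ (x∈p─q⁻ S T (sub d∈D))
            a∉D = λ a∈D → proj₂ (x∈p─q⁻ S T (sub a∈D)) a∈T
            c , y , c∈D , y∉D , y∈S , c~y = reach-exit D (S-conn d∈S (T⊆S a∈T)) d∈D a∉D
            y∈T = decidable-stable (y ∈? T) λ y∉T → y∉D (closed c∈D (x∈p─q⁺ (y∈S , y∉T)) c~y)
        in y , y∈T , y∉D , c , c∈D , c~y

      attachment-unique : ∀ {t t'} → t ∈ T → t' ∈ T → NbrOf G D t → NbrOf G D t' → t ≡ t'
      attachment-unique t∈T t'∈T (_ , c , c∈D , c~t) (_ , c' , c'∈D , c'~t') =
        attached-unique (T⊆T₀ t∈T) (T⊆T₀ t'∈T)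
          (c , sym G c~t , here (S─T⊆R (sub c∈D)))
          (c' , sym G c'~t' , reach-mono (S─T⊆R ∘ sub) (conn c'∈D c∈D))

    T-isRoot : ∀ {a} → a ∈ T → IsRoot G H S T
    T-isRoot a∈T = record
      { sub      = T⊆S
      ; nonempty = _ , a∈T
      ; conn     = T-connected
      ; hfree    = IsRoot.hfree T₀-root ∘ copy-mono T⊆T₀
      ; oneNbr   = λ (D , D-comp) →
          let t , t∈T , t-D = attachment-exists D-comp a∈T in
          t , (t∈T , t-D) , λ t'∈T t'-D → attachment-unique D-comp t'∈T t∈T t'-D t-D
      }

  bed-mono : ∀ {H S S' k k'} → S ⊆ S' → IsBed G H S' k → IsBed G H S k' → k' ≤ k
  bed-mono _ _ (empty _) = z≤n
  bed-mono S⊆S' bed' (free _ _ bed) = bed-mono (S⊆S' ∘ proj₁ ∘ x∈p─q⁻ _ _) bed' bed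
  bed-mono S⊆S' bed' (comps _ _ _ f _ (C , refl)) =
    bed-mono (S⊆S' ∘ IsComponent.sub (proj₂ C)) bed' (proj₂ (f C))
  bed-mono S⊆S' (empty S'-empty) (root (u , u∈S) _ _ _ _ _) = ⊥-elim (S'-empty (u , S⊆S' u∈S))
  bed-mono {S = S} {S'} S⊆S' (free {v = v} _ v∉copy bed') bed@(root _ inCopy _ _ _ _)
    with v ∈? S
  ... | yes v∈S = ⊥-elim (v∉copy (inCopy-mono S⊆S' (inCopy v∈S)))
  ... | no  v∉S = bed-mono S⊆S'-v bed' bed
    where
      S⊆S'-v : S ⊆ S' - v
      S⊆S'-v = ⊆-─ S⊆S' λ x∈S x∈⁅v⁆ → v∉S (≡.subst (_∈ S) (x∈⁅y⁆⇒x≡y v x∈⁅v⁆) x∈S)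
  bed-mono S⊆S' (comps _ _ _ f f≤k _) bed@(root (u , u∈S) _ one _ _ _) =
    ≤-trans (bed-mono (⊆-componentOf (¬many⇒connected one) S⊆S' u∈S) (proj₂ (f C)) bed) (f≤k C)
    where C = component (S⊆S' u∈S)
  bed-mono {H} {S} {S'} S⊆S' (root _ _ _ f T₀ _) bed@(root _ _ one f' _ minimal)
    with nonempty? (S ∩ proj₁ T₀)
  ... | no S∩T₀-empty = ≤-trans (bed-mono S⊆S'─T₀ (proj₂ (f T₀)) bed) (n≤1+n _)
    where
      S⊆S'─T₀ : S ⊆ S' ─ proj₁ T₀
      S⊆S'─T₀ = ⊆-─ S⊆S' λ x∈S x∈T₀ → S∩T₀-empty (_ , x∈p∩q⁺ (x∈S , x∈T₀))
  ... | yes (_ , a∈T) =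
    s≤s (≤-trans (minimal T) (bed-mono S─T⊆R (proj₂ (f T₀)) (proj₂ (f' T))))
    where
      open RootRestriction S⊆S' (proj₂ T₀) (¬many⇒connected one) using (S─T⊆R; T-isRoot)
      T : Root G H S
      T = S ∩ proj₁ T₀ , T-isRoot a∈T

lemma17 : (H G : Graph) (S : Subset (size G)) (k k' : ℕ) →
          IsBed G H ⊤ k → IsBed G H S k' → k' ≤ k
lemma17 H G S k k' bed-G bed-S = decidable-stable (k' ≤? k)
  (¬¬-map (λ reach? → bed-mono reach? ⊆⊤ bed-G bed-S) (¬¬-reach? G))
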